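{- Let $n\ge1$ and let $\pi\in S_n$ avoid the classical pattern $231$. Then the number of occurrences of the vincular pattern $2\underline{13}$ in $\pi$ equals $n-\mathrm{rmax}(\pi)-\mathrm{rmin}(\pi)+1$.
   Context: $S_n$ is the set of permutations of $[n]$ in one-line notation. $\pi$ avoids $231$ if there are no indices $a<b<c$ with $\pi_c<\pi_a<\pi_b$. The number of occurrences of $2\underline{13}$ is $\#\{(x,y): 1\le x<y<n,\ \pi_y<\pi_x<\pi_{y+1}\}$. $\mathrm{rmax}(\pi)$ is the number of right-to-left maxima, i.e. of indices $i$ with $\pi_i>\pi_j$ for all $j>i$; $\mathrm{rmin}(\pi)$ is the number of right-to-left minima, i.e. of indices $i$ with $\pi_i<\pi_j$ for all $j>i$. -}

module Defs where

open import Data.Nat using (ℕ; zero; suc; _<_; _<?_)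
open import Data.Fin using (Fin; toℕ)
open import Data.Fin.Properties using () renaming (_<?_ to _<ᶠ?_)
open import Data.List using (List; length; filter; allFin; cartesianProduct)
open import Data.List.Relation.Unary.All using (All)
open import Data.List.Relation.Unary.All.Properties using ()
open import Data.Product using (_×_; _,_; Σ; proj₁; proj₂)
open import Data.Empty using (⊥)
open import Function.Definitions using (Injective)
open import Relation.Binary.PropositionalEquality using (_≡_)
open import Relation.Nullary using (¬_; Dec; yes; no)
open import Relation.Nullary.Decidable using (_×-dec_; _→-dec_)
open import Data.Fin.Properties using (all?)
open import Relation.Unary using (Decidable)
import Data.List.Relation.Unary.All as All

-- A permutation of [n] in one-line notation: π i is the value at position i
-- (positions and values are 0-indexed, i.e. Fin n stands for [n]).
-- An injective map Fin n → Fin n is a bijection.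
record Perm (n : ℕ) : Set where
  constructor perm
  field
    fun : Fin n → Fin n
    inj : Injective _≡_ _≡_ fun
open Perm public

val : ∀ {n} → Perm n → Fin n → ℕ
val π i = toℕ (fun π i)

Avoids231 : ∀ {n} → Perm n → Set
Avoids231 {n} π = (a b c : Fin n) → toℕ a < toℕ b → toℕ b < toℕ c →
  ¬ (val π c < val π a × val π a < val π b)

-- Positions: x , y range over Fin n; "y+1" is expressed by a position z with toℕ z ≡ suc (toℕ y).
-- We count pairs (x , z) with z a position such that z = y+1 for y = z-1, i.e. triples (x, y, z)
-- with toℕ z ≡ suc (toℕ y); since z is determined by y, this counts pairs (x,y).
Occ213 : ∀ {n} → Perm n → Fin n → Fin n → Fin n → Set
Occ213 π x y z = toℕ x < toℕ y × toℕ z ≡ suc (toℕ y) × val π y < val π x × val π x < val π z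

occ213? : ∀ {n} (π : Perm n) (x y z : Fin n) → Dec (Occ213 π x y z)
occ213? π x y z =
  (toℕ x <? toℕ y) ×-dec ((toℕ z Data.Nat.≟ suc (toℕ y)) ×-dec
    ((val π y <? val π x) ×-dec (val π x <? val π z)))

triples : (n : ℕ) → List (Fin n × Fin n × Fin n)
triples n = cartesianProduct (allFin n) (cartesianProduct (allFin n) (allFin n))

count213 : ∀ {n} → Perm n → ℕ
count213 {n} π = length (filter (λ t → occ213? π (proj₁ t) (proj₁ (proj₂ t)) (proj₂ (proj₂ t))) (triples n))

IsRmax : ∀ {n} → Perm n → Fin n → Set
IsRmax {n} π i = (j : Fin n) → toℕ i < toℕ j → val π j < val π i

IsRmin : ∀ {n} → Perm n → Fin n → Set
IsRmin {n} π i = (j : Fin n) → toℕ i < toℕ j → val π i < val π j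

isRmax? : ∀ {n} (π : Perm n) (i : Fin n) → Dec (IsRmax π i)
isRmax? π i = all? (λ j → (toℕ i <? toℕ j) →-dec (val π j <? val π i))

isRmin? : ∀ {n} (π : Perm n) (i : Fin n) → Dec (IsRmin π i)
isRmin? π i = all? (λ j → (toℕ i <? toℕ j) →-dec (val π i <? val π j))

rmax : ∀ {n} → Perm n → ℕ
rmax {n} π = length (filter (isRmax? π) (allFin n))

rmin : ∀ {n} → Perm n → ℕ
rmin {n} π = length (filter (isRmin? π) (allFin n))

{-# OPTIONS --safe #-}
module Submission where

-- Count the occurrences of 2-13 by the position x of their "2". If x is a right-to-left
-- maximum or minimum there is none. Otherwise some later value exceeds π x and some later
-- value is below it; avoiding 231 forces all later values below π x to come before all
-- later values above it, so after x the sequence crosses the level π x upwards at exactly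
-- one adjacent pair y, y+1. Hence occ(x) + [x rmax] + [x rmin] = 1 + [x is last] for
-- every x, and summing over x gives count213 + rmax + rmin = n + 1.

open import Defs
open import Data.Nat as ℕ using (ℕ; zero; suc; _≤_; _<_; _≮_; _<?_; _≟_; z≤n; s≤s; s≤s⁻¹)
open import Data.Integer using (+_; _+_; _-_)
open import Data.Nat.Properties
  using ( <-cmp; <-asym; <⇒≢; >⇒≢; <⇒≱; ≮⇒≥; ≤∧≢⇒<; ≤-refl; <-trans; <-≤-trans; ≤-<-trans
        ; n<1+n; m<n⇒m<1+n; suc-injective; +-identityʳ; +-0-commutativeMonoid; anyUpTo?; allUpTo?)
open import Data.Fin using (Fin; toℕ; fromℕ<; punchIn)
open import Data.Fin.Properties using (toℕ-injective; toℕ-fromℕ<; fromℕ<-toℕ; toℕ<n; toℕ-fromℕ; punchInᵢ≢i)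
open import Data.List using (List; []; _∷_; _++_; length; filter; map; tabulate; allFin; cartesianProduct)
open import Data.List.Properties using (filter-++; length-++)
open import Data.Product using (_×_; _,_; Σ; ∃-syntax; proj₁; proj₂)
open import Function using (_∘_; id; _⇔_; mk⇔; Equivalence)
open import Relation.Binary using (tri<; tri≈; tri>)
open import Relation.Binary.PropositionalEquality using (_≡_; _≢_; refl; sym; trans; cong; cong₂; subst; subst₂; module ≡-Reasoning)
open import Data.Empty using (⊥-elim)
open import Relation.Nullary using (¬_; Dec; yes; no; contradiction)
open import Relation.Nullary.Decidable using (_×-dec_; _→-dec_)
open import Relation.Unary using (Decidable)
open import Algebra.Properties.CommutativeMonoid.Sum +-0-commutativeMonoid
  using (sum; sum-syntax; sum-cong-≗; sum-replicate-zero; sum-remove; ∑-distrib-+)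
open import Data.Integer.Solver using (module +-*-Solver)

𝟙 : ∀ {P : Set} → Dec P → ℕ
𝟙 (yes _) = 1
𝟙 (no _) = 0

𝟙-yes : ∀ {P : Set} (P? : Dec P) → P → 𝟙 P? ≡ 1
𝟙-yes (yes _) _ = refl
𝟙-yes (no ¬p) p = contradiction p ¬p

𝟙-no : ∀ {P : Set} (P? : Dec P) → ¬ P → 𝟙 P? ≡ 0
𝟙-no (yes p) ¬p = contradiction p ¬p
𝟙-no (no _) _ = refl

𝟙-cong : ∀ {P Q : Set} → P ⇔ Q → (P? : Dec P) (Q? : Dec Q) → 𝟙 P? ≡ 𝟙 Q?
𝟙-cong P⇔Q P? (yes q) = 𝟙-yes P? (Equivalence.from P⇔Q q)
𝟙-cong P⇔Q P? (no ¬q) = 𝟙-no P? (¬q ∘ Equivalence.to P⇔Q)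

∑-const-1 : ∀ n → ∑[ i < n ] 1 ≡ n
∑-const-1 zero = refl
∑-const-1 (suc n) = cong suc (∑-const-1 n)

∑-zero : ∀ {n} (f : Fin n → ℕ) → (∀ i → f i ≡ 0) → ∑[ i < n ] f i ≡ 0
∑-zero {n} f f≡0 = trans (sum-cong-≗ f≡0) (sum-replicate-zero n)

∑-δ : ∀ {n} (f : Fin n → ℕ) (k : Fin n) → (∀ i → i ≢ k → f i ≡ 0) → ∑[ i < n ] f i ≡ f k
∑-δ {suc n} f k off-k = begin
  sum f                        ≡⟨ sum-remove {i = k} f ⟩
  f k ℕ.+ sum (f ∘ punchIn k)  ≡⟨ cong (f k ℕ.+_) (∑-zero _ (λ i → off-k _ (punchInᵢ≢i k i))) ⟩
  f k ℕ.+ 0                    ≡⟨ +-identityʳ (f k) ⟩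
  f k                          ∎
  where open ≡-Reasoning

∑-𝟙-none : ∀ {n} {P : Fin n → Set} (P? : Decidable P) → (∀ i → ¬ P i) → ∑[ i < n ] 𝟙 (P? i) ≡ 0
∑-𝟙-none P? ¬P = ∑-zero _ (λ i → 𝟙-no (P? i) (¬P i))

∑-𝟙-unique : ∀ {n} {P : Fin n → Set} (P? : Decidable P) {k} →
  (∀ {i j} → P i → P j → i ≡ j) → P k → ∑[ i < n ] 𝟙 (P? i) ≡ 1
∑-𝟙-unique P? {k} unique Pk =
  trans (∑-δ _ k (λ i i≢k → 𝟙-no (P? i) (λ Pi → i≢k (unique Pi Pk)))) (𝟙-yes (P? k) Pk)

length-filter-tabulate : ∀ {A : Set} {P : A → Set} (P? : Decidable P) {n} (f : Fin n → A) →
  length (filter P? (tabulate f)) ≡ ∑[ i < n ] 𝟙 (P? (f i))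
length-filter-tabulate P? {zero} f = refl
length-filter-tabulate P? {suc n} f with P? (f Fin.zero)
... | yes _ = cong suc (length-filter-tabulate P? (f ∘ Fin.suc))
... | no _ = length-filter-tabulate P? (f ∘ Fin.suc)

length-filter-map : ∀ {A B : Set} {P : B → Set} (P? : Decidable P) (g : A → B) (xs : List A) →
  length (filter P? (map g xs)) ≡ length (filter (P? ∘ g) xs)
length-filter-map P? g [] = refl
length-filter-map P? g (x ∷ xs) with P? (g x)
... | yes _ = cong suc (length-filter-map P? g xs)
... | no _ = length-filter-map P? g xs

length-filter-cartesianProduct : ∀ {A B : Set} {P : A × B → Set} (P? : Decidable P) {n}
  (f : Fin n → A) (ys : List B) →
  length (filter P? (cartesianProduct (tabulate f) ys)) ≡ ∑[ i < n ] length (filter (λ y → P? (f i , y)) ys)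
length-filter-cartesianProduct P? {zero} f ys = refl
length-filter-cartesianProduct P? {suc n} f ys = begin
  length (filter P? (map (f₀ ,_) ys ++ rest))
    ≡⟨ cong length (filter-++ P? (map (f₀ ,_) ys) rest) ⟩
  length (filter P? (map (f₀ ,_) ys) ++ filter P? rest)
    ≡⟨ length-++ (filter P? (map (f₀ ,_) ys)) ⟩
  length (filter P? (map (f₀ ,_) ys)) ℕ.+ length (filter P? rest)
    ≡⟨ cong₂ ℕ._+_ (length-filter-map P? (f₀ ,_) ys)
                   (length-filter-cartesianProduct P? (f ∘ Fin.suc) ys) ⟩
  _ ∎
  where
  open ≡-Reasoning
  f₀ = f Fin.zero
  rest = cartesianProduct (tabulate (f ∘ Fin.suc)) ys

crossing : ∀ {P : ℕ → Set} → Decidable P → ∀ {k j} → P k → ¬ P j → k ≤ j →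
  ∃[ y ] k ≤ y × y < j × P y × ¬ P (suc y)
crossing P? {j = zero} Pk ¬P₀ z≤n = contradiction Pk ¬P₀
crossing P? {k} {suc j} Pk ¬Pj+1 k≤j+1
  with k≤j ← s≤s⁻¹ (≤∧≢⇒< k≤j+1 λ { refl → ¬Pj+1 Pk }) | P? j
... | yes Pj = j , k≤j , ≤-refl , Pj , ¬Pj+1
... | no ¬Pj with y , k≤y , y<j , Py , ¬Py+1 ← crossing P? Pk ¬Pj k≤j =
  y , k≤y , m<n⇒m<1+n y<j , Py , ¬Py+1

module Avoiding231
  (n : ℕ) (p : ℕ → ℕ)
  (p-injective : ∀ {i j} → i < n → j < n → p i ≡ p j → i ≡ j)
  (avoids231 : ∀ {a b c} → a < b → b < c → c < n → ¬ (p c < p a × p a < p b))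
  where

  RightMax RightMin : ℕ → Set
  RightMax x = ∀ {j} → j < n → x < j → p j < p x
  RightMin x = ∀ {j} → j < n → x < j → p x < p j

  rightMax? : Decidable RightMax
  rightMax? x = allUpTo? (λ j → x <? j →-dec p j <? p x) n

  rightMin? : Decidable RightMin
  rightMin? x = allUpTo? (λ j → x <? j →-dec p x <? p j) n

  Occurrence : ℕ → ℕ → Set
  Occurrence x y = x < y × suc y < n × p y < p x × p x < p (suc y)

  occurrence? : ∀ x y → Dec (Occurrence x y)
  occurrence? x y = (x <? y) ×-dec (suc y <? n) ×-dec (p y <? p x) ×-dec (p x <? p (suc y))

  occurrences : ℕ → ℕ
  occurrences x = ∑[ y < n ] 𝟙 (occurrence? x (toℕ y))

  ≮⇒> : ∀ {i j} → i < n → j < n → i ≢ j → p i ≮ p j → p j < p i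
  ≮⇒> i<n j<n i≢j pi≮pj = ≤∧≢⇒< (≮⇒≥ pi≮pj) (λ e → i≢j (sym (p-injective j<n i<n e)))

  higher-later : ∀ {x} → x < n → ¬ RightMax x → ∃[ j ] j < n × x < j × p x < p j
  higher-later {x} x<n ¬max with anyUpTo? (λ j → x <? j ×-dec p x <? p j) n
  ... | yes (j , j<n , found) = j , j<n , found
  ... | no none = contradiction
    (λ {j} j<n x<j → ≮⇒> x<n j<n (<⇒≢ x<j) (λ px<pj → none (_ , j<n , x<j , px<pj))) ¬max

  lower-later : ∀ {x} → x < n → ¬ RightMin x → ∃[ j ] j < n × x < j × p j < p x
  lower-later {x} x<n ¬min with anyUpTo? (λ j → x <? j ×-dec p j <? p x) n
  ... | yes (j , j<n , found) = j , j<n , found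
  ... | no none = contradiction
    (λ {j} j<n x<j → ≮⇒> j<n x<n (>⇒≢ x<j) (λ pj<px → none (_ , j<n , x<j , pj<px))) ¬min

  no-later-occurrence : ∀ {x y y′} → y < y′ → Occurrence x y → ¬ Occurrence x y′
  no-later-occurrence {y = y} y<y′ (x<y , _ , _ , px<py+1) (_ , y′+1<n , py′<px , _)
    with ≤∧≢⇒< y<y′ (λ { refl → <-asym px<py+1 py′<px })
  ... | y+1<y′ = avoids231 (<-trans x<y (n<1+n y)) y+1<y′ (<-trans (n<1+n _) y′+1<n) (py′<px , px<py+1)

  occurrence-unique : ∀ {x y y′} → Occurrence x y → Occurrence x y′ → y ≡ y′
  occurrence-unique {y = y} {y′} o o′ with <-cmp y y′
  ... | tri< y<y′ _ _ = contradiction o′ (no-later-occurrence y<y′ o)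
  ... | tri≈ _ y≡y′ _ = y≡y′
  ... | tri> _ _ y′<y = contradiction o (no-later-occurrence y′<y o′)

  rightMax⇒no-occurrence : ∀ {x y} → RightMax x → ¬ Occurrence x y
  rightMax⇒no-occurrence max (x<y , y+1<n , _ , px<py+1) = <-asym px<py+1 (max y+1<n (<-trans x<y (n<1+n _)))

  rightMin⇒no-occurrence : ∀ {x y} → RightMin x → ¬ Occurrence x y
  rightMin⇒no-occurrence min (x<y , y+1<n , py<px , _) = <-asym py<px (min (<-trans (n<1+n _) y+1<n) x<y)

  nothing-after-last : ∀ {x j} → suc x ≡ n → j < n → x ≮ j
  nothing-after-last last j<n x<j = <⇒≱ j<n (subst (_≤ _) last x<j)

  last⇒rightMax : ∀ {x} → suc x ≡ n → RightMax x
  last⇒rightMax last j<n x<j = contradiction x<j (nothing-after-last last j<n)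

  last⇒rightMin : ∀ {x} → suc x ≡ n → RightMin x
  last⇒rightMin last j<n x<j = contradiction x<j (nothing-after-last last j<n)

  last⇒no-occurrence : ∀ {x y} → suc x ≡ n → ¬ Occurrence x y
  last⇒no-occurrence last (x<y , y+1<n , _) = nothing-after-last last (<-trans (n<1+n _) y+1<n) x<y

  lower-before-higher : ∀ {x j k} → x < j → k < n → p k < p x → p x < p j → k ≤ j
  lower-before-higher x<j k<n pk<px px<pj = ≮⇒≥ (λ j<k → avoids231 x<j j<k k<n (pk<px , px<pj))

  occurrence-exists : ∀ {x} → x < n → ¬ RightMax x → ¬ RightMin x → ∃[ y ] Occurrence x y
  occurrence-exists {x} x<n ¬max ¬min
    with j , j<n , x<j , px<pj ← higher-later x<n ¬max
       | k , k<n , x<k , pk<px ← lower-later x<n ¬min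
    with y , k≤y , y<j , py<px , py+1≮px ←
           crossing (λ y → p y <? p x) pk<px (<-asym px<pj) (lower-before-higher x<j k<n pk<px px<pj) =
    y , x<y , y+1<n , py<px , ≮⇒> y+1<n x<n (>⇒≢ (<-trans x<y (n<1+n y))) py+1≮px
    where
    x<y = <-≤-trans x<k k≤y
    y+1<n = ≤-<-trans y<j j<n

  occurrences-none : ∀ {x} → (∀ {y} → ¬ Occurrence x y) → occurrences x ≡ 0
  occurrences-none {x} none = ∑-𝟙-none {n} (λ y → occurrence? x (toℕ y)) (λ _ → none)

  occurrences-one : ∀ {x y} → Occurrence x y → occurrences x ≡ 1
  occurrences-one {x} o@(_ , y+1<n , _) =
    ∑-𝟙-unique {n} (λ y → occurrence? x (toℕ y)) (λ o o′ → toℕ-injective (occurrence-unique o o′))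
      (subst (Occurrence x) (sym (toℕ-fromℕ< y<n)) o)
    where y<n = <-trans (n<1+n _) y+1<n

  occurrences-rightMax-rightMin : ∀ {x} → x < n →
    occurrences x ℕ.+ 𝟙 (rightMax? x) ℕ.+ 𝟙 (rightMin? x) ≡ 1 ℕ.+ 𝟙 (suc x ≟ n)
  occurrences-rightMax-rightMin {x} x<n with suc x ≟ n | rightMax? x | rightMin? x
  ... | yes last | yes _ | yes _ = cong (λ c → c ℕ.+ 1 ℕ.+ 1) (occurrences-none (last⇒no-occurrence last))
  ... | yes last | no ¬max | _ = ⊥-elim (¬max (last⇒rightMax last))
  ... | yes last | _ | no ¬min = ⊥-elim (¬min (last⇒rightMin last))
  ... | no ¬last | yes max | yes min =
    contradiction (max x+1<n (n<1+n x)) (<-asym (min x+1<n (n<1+n x)))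
    where x+1<n = ≤∧≢⇒< x<n ¬last
  ... | no _ | yes max | no _ = cong (λ c → c ℕ.+ 1 ℕ.+ 0) (occurrences-none (rightMax⇒no-occurrence max))
  ... | no _ | no _ | yes min = cong (λ c → c ℕ.+ 0 ℕ.+ 1) (occurrences-none (rightMin⇒no-occurrence min))
  ... | no _ | no ¬max | no ¬min =
    cong (λ c → c ℕ.+ 0 ℕ.+ 0) (occurrences-one (proj₂ (occurrence-exists x<n ¬max ¬min)))

-- Positions ≥ n carry the junk value 0; only positions below n are ever inspected.
extend : ∀ {n} → (Fin n → ℕ) → ℕ → ℕ
extend {n} f i with i <? n
... | yes i<n = f (fromℕ< i<n)
... | no _ = 0

extend-toℕ : ∀ {n} (f : Fin n → ℕ) (i : Fin n) → extend f (toℕ i) ≡ f i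
extend-toℕ {n} f i with toℕ i <? n
... | yes i<n = cong f (fromℕ<-toℕ i i<n)
... | no i≮n = contradiction (toℕ<n i) i≮n

toℕ-surjective : ∀ {n i} → i < n → Σ (Fin n) λ k → toℕ k ≡ i
toℕ-surjective i<n = fromℕ< i<n , toℕ-fromℕ< i<n

module _ {n : ℕ} (π : Perm n) (avoids : Avoids231 π) where

  p : ℕ → ℕ
  p = extend (val π)

  p-toℕ : ∀ i → p (toℕ i) ≡ val π i
  p-toℕ = extend-toℕ (val π)

  p-injective : ∀ {i j} → i < n → j < n → p i ≡ p j → i ≡ j
  p-injective i<n j<n e with (k , refl) ← toℕ-surjective i<n | (l , refl) ← toℕ-surjective j<n =
    cong toℕ (inj π (toℕ-injective (trans (sym (p-toℕ k)) (trans e (p-toℕ l)))))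

  p-avoids231 : ∀ {a b c} → a < b → b < c → c < n → ¬ (p c < p a × p a < p b)
  p-avoids231 a<b b<c c<n (pc<pa , pa<pb)
    with (c , refl) ← toℕ-surjective c<n
       | (b , refl) ← toℕ-surjective (<-trans b<c c<n)
       | (a , refl) ← toℕ-surjective (<-trans a<b (<-trans b<c c<n)) =
    avoids a b c a<b b<c (subst₂ _<_ (p-toℕ c) (p-toℕ a) pc<pa , subst₂ _<_ (p-toℕ a) (p-toℕ b) pa<pb)

  open Avoiding231 n p p-injective p-avoids231

  isRmax⇔rightMax : ∀ i → IsRmax π i ⇔ RightMax (toℕ i)
  isRmax⇔rightMax i = mk⇔ to from
    where
    to : IsRmax π i → RightMax (toℕ i)
    to R j<n i<j with (k , refl) ← toℕ-surjective j<n =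
      subst₂ _<_ (sym (p-toℕ k)) (sym (p-toℕ i)) (R k i<j)
    from : RightMax (toℕ i) → IsRmax π i
    from r j i<j = subst₂ _<_ (p-toℕ j) (p-toℕ i) (r (toℕ<n j) i<j)

  isRmin⇔rightMin : ∀ i → IsRmin π i ⇔ RightMin (toℕ i)
  isRmin⇔rightMin i = mk⇔ to from
    where
    to : IsRmin π i → RightMin (toℕ i)
    to R j<n i<j with (k , refl) ← toℕ-surjective j<n =
      subst₂ _<_ (sym (p-toℕ i)) (sym (p-toℕ k)) (R k i<j)
    from : RightMin (toℕ i) → IsRmin π i
    from r j i<j = subst₂ _<_ (p-toℕ i) (p-toℕ j) (r (toℕ<n j) i<j)

  occ213⇒occurrence : ∀ {x y z} → Occ213 π x y z → Occurrence (toℕ x) (toℕ y)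
  occ213⇒occurrence {x} {y} {z} (x<y , z≡y+1 , πy<πx , πx<πz) =
    x<y , subst (_< n) z≡y+1 (toℕ<n z) , subst₂ _<_ (sym (p-toℕ y)) (sym (p-toℕ x)) πy<πx ,
    subst (λ j → p (toℕ x) < p j) z≡y+1 (subst₂ _<_ (sym (p-toℕ x)) (sym (p-toℕ z)) πx<πz)

  occurrence⇒occ213 : ∀ {x y} → (o : Occurrence (toℕ x) (toℕ y)) → Occ213 π x y (fromℕ< (proj₁ (proj₂ o)))
  occurrence⇒occ213 {x} {y} (x<y , y+1<n , py<px , px<py+1) =
    x<y , toℕ-fromℕ< y+1<n , subst₂ _<_ (p-toℕ y) (p-toℕ x) py<px ,
    subst₂ _<_ (p-toℕ x) (trans (cong p (sym (toℕ-fromℕ< y+1<n))) (p-toℕ _)) px<py+1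

  ∑-occ213 : ∀ x y → ∑[ z < n ] 𝟙 (occ213? π x y z) ≡ 𝟙 (occurrence? (toℕ x) (toℕ y))
  ∑-occ213 x y with occurrence? (toℕ x) (toℕ y)
  ... | yes o = ∑-𝟙-unique (occ213? π x y)
    (λ (_ , e , _) (_ , e′ , _) → toℕ-injective (trans e (sym e′))) (occurrence⇒occ213 o)
  ... | no ¬o = ∑-𝟙-none (occ213? π x y) (λ _ → ¬o ∘ occ213⇒occurrence)

  count213≡∑occurrences : count213 π ≡ ∑[ x < n ] occurrences (toℕ x)
  count213≡∑occurrences =
    trans (length-filter-cartesianProduct (λ (x , y , z) → occ213? π x y z) id
             (cartesianProduct (allFin n) (allFin n))) (sum-cong-≗ λ x →
    trans (length-filter-cartesianProduct (λ (y , z) → occ213? π x y z) id (allFin n)) (sum-cong-≗ λ y →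
    trans (length-filter-tabulate (occ213? π x y) id) (∑-occ213 x y)))

  ∑-last : 1 ≤ n → ∑[ x < n ] 𝟙 (suc (toℕ x) ≟ n) ≡ 1
  ∑-last (s≤s {n = m} _) =
    ∑-𝟙-unique (λ x → suc (toℕ x) ≟ suc m)
      (λ e e′ → toℕ-injective (suc-injective (trans e (sym e′)))) (cong suc (toℕ-fromℕ m))

  rmax≡∑rightMax : rmax π ≡ ∑[ x < n ] 𝟙 (rightMax? (toℕ x))
  rmax≡∑rightMax = trans (length-filter-tabulate (isRmax? π) id)
    (sum-cong-≗ λ x → 𝟙-cong (isRmax⇔rightMax x) (isRmax? π x) (rightMax? (toℕ x)))

  rmin≡∑rightMin : rmin π ≡ ∑[ x < n ] 𝟙 (rightMin? (toℕ x))
  rmin≡∑rightMin = trans (length-filter-tabulate (isRmin? π) id)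
    (sum-cong-≗ λ x → 𝟙-cong (isRmin⇔rightMin x) (isRmin? π x) (rightMin? (toℕ x)))

  count213+rmax+rmin : 1 ≤ n → count213 π ℕ.+ rmax π ℕ.+ rmin π ≡ n ℕ.+ 1
  count213+rmax+rmin 1≤n = begin
    count213 π ℕ.+ rmax π ℕ.+ rmin π
      ≡⟨ cong₂ ℕ._+_ (cong₂ ℕ._+_ count213≡∑occurrences rmax≡∑rightMax) rmin≡∑rightMin ⟩
    sum occ ℕ.+ sum max ℕ.+ sum min
      ≡⟨ cong (ℕ._+ sum min) (∑-distrib-+ occ max) ⟨
    ∑[ x < n ] (occ x ℕ.+ max x) ℕ.+ sum min
      ≡⟨ ∑-distrib-+ (λ x → occ x ℕ.+ max x) min ⟨
    ∑[ x < n ] (occ x ℕ.+ max x ℕ.+ min x)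
      ≡⟨ sum-cong-≗ (λ x → occurrences-rightMax-rightMin (toℕ<n x)) ⟩
    ∑[ x < n ] (1 ℕ.+ last x)
      ≡⟨ ∑-distrib-+ (λ _ → 1) last ⟩
    ∑[ x < n ] 1 ℕ.+ sum last
      ≡⟨ cong₂ ℕ._+_ (∑-const-1 n) (∑-last 1≤n) ⟩
    n ℕ.+ 1 ∎
    where
    open ≡-Reasoning
    occ max min last : Fin n → ℕ
    occ x = occurrences (toℕ x)
    max x = 𝟙 (rightMax? (toℕ x))
    min x = 𝟙 (rightMin? (toℕ x))
    last x = 𝟙 (suc (toℕ x) ≟ n)

+-≡⇒ℤ-difference : ∀ {c a b m d} → c ℕ.+ a ℕ.+ b ≡ m ℕ.+ d → + c ≡ + m - + a - + b + + d
+-≡⇒ℤ-difference {c} {a} {b} {m} {d} e = begin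
  + c                           ≡⟨ solve 3 (λ c a b → c := c :+ a :+ b :- a :- b) refl (+ c) (+ a) (+ b) ⟩
  + (c ℕ.+ a ℕ.+ b) - + a - + b ≡⟨ cong (λ s → + s - + a - + b) e ⟩
  + (m ℕ.+ d) - + a - + b       ≡⟨ solve 4 (λ m d a b → m :+ d :- a :- b := m :- a :- b :+ d) refl (+ m) (+ d) (+ a) (+ b) ⟩
  + m - + a - + b + + d         ∎
  where
  open ≡-Reasoning
  open +-*-Solver

lemma3p17 : (n : ℕ) → 1 ≤ n → (π : Perm n) → Avoids231 π →
    + count213 π ≡ + n - + rmax π - + rmin π + + 1
lemma3p17 n 1≤n π avoids = +-≡⇒ℤ-difference (count213+rmax+rmin π avoids 1≤n)
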